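{- Let $n\ge 4$ be an even integer. If $G$ is an $(n-3)$-regular graph on $n$ vertices that is $(a,d)$-distance antimagic, then $d=1$.
   Context: For integers $a$ and $d\ge 0$, an $(a,d)$-distance antimagic labeling of a graph $G$ on $n$ vertices is a bijection $f:V(G)\to\{1,\dots,n\}$ such that the set of vertex weights $\{w_G(u)=\sum_{v\in N_G(u)}f(v): u\in V(G)\}$ equals $\{a,a+d,\dots,a+(n-1)d\}$; $G$ is $(a,d)$-distance antimagic if it admits such a labeling. -}

module Defs where

open import Data.Nat using (ℕ; zero; suc; _+_; _*_)
open import Data.Bool using (Bool; true; false; if_then_else_)
open import Data.Fin using (Fin; toℕ)
open import Data.Fin.Subset using (Subset; ∣_∣)
open import Data.Integer as ℤ using (ℤ; +_)
open import Data.Product using (Σ; _×_; ∃; ∃-syntax)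
open import Data.Vec using (tabulate)
open import Function.Bundles using (Bijection)
open import Relation.Binary.PropositionalEquality using (_≡_; _≢_; setoid)

record Graph (n : ℕ) : Set where
  field
    adj       : Fin n → Fin n → Bool
    symmetric : ∀ u v → adj u v ≡ adj v u
    loopless  : ∀ u → adj u u ≡ false
open Graph public

sumFin : (n : ℕ) → (Fin n → ℕ) → ℕ
sumFin zero    g = 0
sumFin (suc n) g = g Fin.zero + sumFin n (λ i → g (Fin.suc i))

N : ∀ {n} → Graph n → Fin n → Subset n
N G u = tabulate (adj G u)

degree : ∀ {n} → Graph n → Fin n → ℕ
degree G u = ∣ N G u ∣

IsRegular : ∀ {n} → ℕ → Graph n → Set
IsRegular k G = ∀ u → degree G u ≡ k

-- A labeling is a bijection f : V(G) → {1,…,n}; we represent {1,…,n}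
-- by Fin n, the label of v being toℕ (f v) + 1.
Labeling : ℕ → Set
Labeling n = Bijection (setoid (Fin n)) (setoid (Fin n))

label : ∀ {n} → Labeling n → Fin n → ℕ
label f v = suc (toℕ (Bijection.to f v))

weight : ∀ {n} → Graph n → Labeling n → Fin n → ℕ
weight G f u = sumFin _ (λ v → if adj G u v then label f v else 0)

-- {w(u) : u ∈ V} = {a, a+d, …, a+(n-1)d}  (equality of sets, a ∈ ℤ, d ∈ ℕ)
IsDistanceAntimagicLabeling : ∀ {n} → Graph n → ℤ → ℕ → Labeling n → Set
IsDistanceAntimagicLabeling {n} G a d f =
  (∀ u → ∃[ i ] (+ weight G f u ≡ a ℤ.+ + (toℕ {n} i * d)))
  × (∀ (i : Fin n) → ∃[ u ] (+ weight G f u ≡ a ℤ.+ + (toℕ i * d)))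

IsDistanceAntimagic : ∀ {n} → Graph n → ℤ → ℕ → Set
IsDistanceAntimagic G a d = ∃[ f ] IsDistanceAntimagicLabeling G a d f

-- Let G be r-regular on n vertices with weights a, a + d, …, a + (n − 1)d.  Each label is
-- counted once for each of its r neighbours, so the weights sum to r·n(n + 1)/2; as a
-- progression they sum to n·a + d·n(n − 1)/2, whence 2a + (n − 1)d = r(n + 1).  A weight is
-- a sum of r distinct labels, so a ≥ 1 + ⋯ + r and a + (n − 1)d ≤ (n − r + 1) + ⋯ + n, giving
-- (n − 1)d ≤ r(n − r).  For r = n − 3 this forces d < 3, and for even n the number r(n + 1)
-- is odd, so d is odd: d = 1.
module Submission where

open import Defs
open import Data.Bool using (Bool; true; false; if_then_else_)
open import Data.Fin using (Fin; zero; suc; toℕ; fromℕ; punchOut; _≟_)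
open import Data.Fin.Permutation using (Permutation; _⟨$⟩ʳ_; _⟨$⟩ˡ_; permutation; flip; inverseʳ)
open import Data.Fin.Properties using (toℕ-injective; toℕ-fromℕ; punchOut-injective; any?; injective⇒≤)
open import Data.Fin.Subset using (∣_∣)
open import Data.Integer as ℤ using (ℤ)
import Data.Integer.Properties as ℤₚ
open import Data.List using ([]; _∷_)
open import Data.Nat using (ℕ; zero; suc; _+_; _*_; _∸_; _≤_; z≤n; s≤s; z<s)
open import Data.Nat.Properties hiding (_≟_)
open import Data.Nat.Tactic.RingSolver using (solve)
open import Data.Product using (_,_; ∃-syntax; proj₁; proj₂; map₂)
open import Data.Vec using (tabulate)
open import Function using (_∘_; Injective)
open import Function.Properties.Bijection using (Bijection⇒Inverse)
open import Data.Empty using (⊥-elim)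
open import Relation.Nullary using (yes; no; contradiction)
open import Relation.Binary.PropositionalEquality

open import Algebra.Properties.Semiring.Sum +-*-semiring
  using (sum; sum-syntax; sum-cong-≗; ∑-distrib-+; ∑-comm; sum-permute; *-distribˡ-sum; *-distribʳ-sum)

sumFin≡sum : ∀ n (g : Fin n → ℕ) → sumFin n g ≡ sum g
sumFin≡sum zero    g = refl
sumFin≡sum (suc n) g = cong (g zero +_) (sumFin≡sum n (g ∘ suc))

∑-const : ∀ n c → ∑[ i < n ] c ≡ n * c
∑-const zero    c = refl
∑-const (suc n) c = cong (c +_) (∑-const n c)

∑-suc : ∀ {n} (g : Fin n → ℕ) → ∑[ i < n ] suc (g i) ≡ sum g + n
∑-suc {n} g = begin
  ∑[ i < n ] suc (g i)  ≡⟨ sum-cong-≗ (λ i → +-comm 1 (g i)) ⟩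
  ∑[ i < n ] (g i + 1)  ≡⟨ ∑-distrib-+ g (λ _ → 1) ⟩
  sum g + ∑[ i < n ] 1  ≡⟨ cong (sum g +_) (trans (∑-const n 1) (*-identityʳ n)) ⟩
  sum g + n             ∎
  where open ≡-Reasoning

gauss : ∀ n → 2 * ∑[ i < suc n ] toℕ i ≡ suc n * n
gauss zero    = refl
gauss (suc n) = begin
  2 * ∑[ i < suc n ] suc (toℕ i)     ≡⟨ cong (2 *_) (∑-suc {suc n} toℕ) ⟩
  2 * (∑[ i < suc n ] toℕ i + suc n) ≡⟨ *-distribˡ-+ 2 (∑[ i < suc n ] toℕ i) (suc n) ⟩
  2 * ∑[ i < suc n ] toℕ i + 2 * suc n ≡⟨ cong (_+ 2 * suc n) (gauss n) ⟩
  suc n * n + 2 * suc n              ≡⟨ solve (n ∷ []) ⟩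
  suc (suc n) * suc n                ∎
  where open ≡-Reasoning

injective⇒surjective : ∀ {n} {σ : Fin n → Fin n} → Injective _≡_ _≡_ σ → ∀ u → ∃[ j ] σ j ≡ u
injective⇒surjective {zero}      _     ()
injective⇒surjective {suc n} {σ} σ-inj u with any? (λ j → σ j ≟ u)
... | yes hit = hit
... | no miss = contradiction (injective⇒≤ σ∖u-inj) 1+n≰n
  where
  σ∖u : Fin (suc n) → Fin n
  σ∖u j = punchOut (λ u≡σj → miss (j , sym u≡σj))

  σ∖u-inj : Injective _≡_ _≡_ σ∖u
  σ∖u-inj {x} {y} = σ-inj ∘ punchOut-injective (λ e → miss (x , sym e)) (λ e → miss (y , sym e))

sum-rearrange-retraction : ∀ {n} (g : Fin n → ℕ) {τ σ : Fin n → Fin n} →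
                           (∀ i → τ (σ i) ≡ i) → sum (g ∘ τ) ≡ sum g
sum-rearrange-retraction {n} g {τ} {σ} τσ = sym (sum-permute g τ-perm)
  where
  σ-inj : Injective _≡_ _≡_ σ
  σ-inj {x} {y} σx≡σy = trans (sym (τσ x)) (trans (cong τ σx≡σy) (τσ y))

  στ : ∀ u → σ (τ u) ≡ u
  στ u with j , refl ← injective⇒surjective σ-inj u = cong σ (τσ j)

  τ-perm : Permutation n n
  τ-perm = permutation τ σ τσ στ

record HasProgressionValues {n} (w : Fin n → ℕ) (b d : ℕ) : Set where
  field
    index  : ∀ u → ∃[ i ] w u ≡ b + toℕ {n} i * d
    vertex : ∀ (i : Fin n) → ∃[ u ] w u ≡ b + toℕ i * d

progression-index-sum : ∀ {n} b d {τ σ : Fin n → Fin n} →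
                        (∀ i → b + toℕ (τ (σ i)) * d ≡ b + toℕ i * d) →
                        (∑[ u < n ] toℕ (τ u)) * d ≡ (∑[ i < n ] toℕ i) * d
progression-index-sum {n} b zero {τ} _ =
  trans (*-zeroʳ (∑[ u < n ] toℕ (τ u))) (sym (*-zeroʳ (∑[ i < n ] toℕ i)))
progression-index-sum b (suc d) {τ} {σ} eq =
  cong (_* suc d) (sum-rearrange-retraction toℕ {τ} {σ} (λ i → toℕ-injective (index-eq i)))
  where
  index-eq : ∀ i → toℕ (τ (σ i)) ≡ toℕ i
  index-eq i = *-cancelʳ-≡ _ _ (suc d) (+-cancelˡ-≡ b _ _ (eq i))

sum-progression : ∀ {n} {w : Fin n → ℕ} {b d} → HasProgressionValues w b d →
                  sum w ≡ n * b + (∑[ i < n ] toℕ i) * d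
sum-progression {n} {w} {b} {d} progression = begin
  sum w                                       ≡⟨ sum-cong-≗ (proj₂ ∘ index) ⟩
  ∑[ u < n ] (b + toℕ (τ u) * d)              ≡⟨ ∑-distrib-+ (λ _ → b) (λ u → toℕ (τ u) * d) ⟩
  ∑[ u < n ] b + ∑[ u < n ] (toℕ (τ u) * d)   ≡⟨ cong₂ _+_ (∑-const n b) (sym (*-distribʳ-sum d (toℕ ∘ τ))) ⟩
  n * b + (∑[ u < n ] toℕ (τ u)) * d          ≡⟨ cong (n * b +_) (progression-index-sum b d {τ} {σ} τσ) ⟩
  n * b + (∑[ i < n ] toℕ i) * d              ∎
  where
  open ≡-Reasoning
  open HasProgressionValues progression
  τ σ : Fin n → Fin n
  τ = proj₁ ∘ index
  σ = proj₁ ∘ vertex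

  τσ : ∀ i → b + toℕ (τ (σ i)) * d ≡ b + toℕ i * d
  τσ i = trans (sym (proj₂ (index (σ i)))) (proj₂ (vertex i))

count : ∀ {n} → (Fin n → Bool) → ℕ
count {n} p = ∑[ i < n ] (if p i then 1 else 0)

rankSum : ∀ {n} → (Fin n → Bool) → ℕ
rankSum {n} p = ∑[ i < n ] (if p i then suc (toℕ i) else 0)

count≤ : ∀ {n} (p : Fin n → Bool) → count p ≤ n
count≤ {zero}  p = z≤n
count≤ {suc n} p with p zero
... | true  = s≤s (count≤ (p ∘ suc))
... | false = m≤n⇒m≤1+n (count≤ (p ∘ suc))

if-suc : ∀ b x → (if b then suc x else 0) ≡ (if b then x else 0) + (if b then 1 else 0)
if-suc true  x = +-comm 1 x
if-suc false x = refl

rankSum-suc : ∀ {n} (p : Fin (suc n) → Bool) →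
              rankSum p ≡ (if p zero then 1 else 0) + (rankSum (p ∘ suc) + count (p ∘ suc))
rankSum-suc p = cong ((if p zero then 1 else 0) +_) (trans
  (sum-cong-≗ (λ i → if-suc (p (suc i)) (suc (toℕ i))))
  (∑-distrib-+ (λ i → if p (suc i) then suc (toℕ i) else 0) (λ i → if p (suc i) then 1 else 0)))

rankSum-lower : ∀ {n} (p : Fin n → Bool) → count p * suc (count p) ≤ 2 * rankSum p
rankSum-lower {zero}  p = z≤n
rankSum-lower {suc n} p rewrite rankSum-suc p with p zero
... | true  = step (count (p ∘ suc)) (rankSum (p ∘ suc)) (rankSum-lower (p ∘ suc))
  where
  step : ∀ k S → k * suc k ≤ 2 * S → suc k * suc (suc k) ≤ 2 * (1 + (S + k))
  step k S ih = begin
    suc k * suc (suc k)       ≡⟨ solve (k ∷ []) ⟩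
    k * suc k + 2 * suc k     ≤⟨ +-monoˡ-≤ (2 * suc k) ih ⟩
    2 * S + 2 * suc k         ≡⟨ solve (S ∷ k ∷ []) ⟩
    2 * (1 + (S + k))         ∎
    where open ≤-Reasoning
... | false =
  ≤-trans (rankSum-lower (p ∘ suc)) (*-monoʳ-≤ 2 (m≤m+n (rankSum (p ∘ suc)) (count (p ∘ suc))))

rankSum-upper : ∀ {n} (p : Fin n → Bool) → 2 * rankSum p + count p * count p ≤ count p * suc (2 * n)
rankSum-upper {zero}  p = z≤n
rankSum-upper {suc n} p rewrite rankSum-suc p with p zero
... | true  = step (count (p ∘ suc)) (rankSum (p ∘ suc)) (rankSum-upper (p ∘ suc)) (count≤ (p ∘ suc))
  where
  step : ∀ k S → 2 * S + k * k ≤ k * suc (2 * n) → k ≤ n →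
         2 * (1 + (S + k)) + suc k * suc k ≤ suc k * suc (2 * suc n)
  step k S ih k≤n = begin
    2 * (1 + (S + k)) + suc k * suc k     ≡⟨ solve (S ∷ k ∷ []) ⟩
    (2 * S + k * k) + (2 * k + (2 * k + 3)) ≤⟨ +-mono-≤ ih (+-monoˡ-≤ (2 * k + 3) (*-monoʳ-≤ 2 k≤n)) ⟩
    k * suc (2 * n) + (2 * n + (2 * k + 3)) ≡⟨ solve (n ∷ k ∷ []) ⟩
    suc k * suc (2 * suc n)               ∎
    where open ≤-Reasoning
... | false = step (count (p ∘ suc)) (rankSum (p ∘ suc)) (rankSum-upper (p ∘ suc))
  where
  step : ∀ k S → 2 * S + k * k ≤ k * suc (2 * n) → 2 * (S + k) + k * k ≤ k * suc (2 * suc n)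
  step k S ih = begin
    2 * (S + k) + k * k         ≡⟨ solve (S ∷ k ∷ []) ⟩
    (2 * S + k * k) + 2 * k     ≤⟨ +-monoˡ-≤ (2 * k) ih ⟩
    k * suc (2 * n) + 2 * k     ≡⟨ solve (n ∷ k ∷ []) ⟩
    k * suc (2 * suc n)         ∎
    where open ≤-Reasoning

if-const : ∀ b c → (if b then c else 0) ≡ c * (if b then 1 else 0)
if-const true  c = sym (*-identityʳ c)
if-const false c = sym (*-zeroʳ c)

∑-if-const : ∀ {n} (p : Fin n → Bool) c → ∑[ i < n ] (if p i then c else 0) ≡ c * count p
∑-if-const p c =
  trans (sum-cong-≗ (λ i → if-const (p i) c)) (sym (*-distribˡ-sum c (λ i → if p i then 1 else 0)))

∣tabulate∣≡count : ∀ {n} (p : Fin n → Bool) → ∣ tabulate p ∣ ≡ count p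
∣tabulate∣≡count {zero}  p = refl
∣tabulate∣≡count {suc n} p with p zero
... | true  = cong suc (∣tabulate∣≡count (p ∘ suc))
... | false = ∣tabulate∣≡count (p ∘ suc)

module _ {n} (G : Graph n) (f : Labeling n) where

  private
    π : Permutation n n
    π = Bijection⇒Inverse f

  neighbourLabels : Fin n → Fin n → Bool
  neighbourLabels u i = adj G u (π ⟨$⟩ˡ i)

  weight≡rankSum : ∀ u → weight G f u ≡ rankSum (neighbourLabels u)
  weight≡rankSum u = begin
    weight G f u
      ≡⟨ sumFin≡sum n _ ⟩
    ∑[ v < n ] (if adj G u v then label f v else 0)
      ≡⟨ sum-permute _ (flip π) ⟩
    ∑[ i < n ] (if neighbourLabels u i then suc (toℕ (π ⟨$⟩ʳ (π ⟨$⟩ˡ i))) else 0)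
      ≡⟨ sum-cong-≗ (λ i → cong (λ j → if neighbourLabels u i then suc (toℕ j) else 0) (inverseʳ π)) ⟩
    rankSum (neighbourLabels u) ∎
    where open ≡-Reasoning

  degree≡count : ∀ u → degree G u ≡ count (neighbourLabels u)
  degree≡count u = trans (∣tabulate∣≡count (adj G u)) (sum-permute _ (flip π))

  sum-label : sum (label f) ≡ ∑[ i < n ] toℕ i + n
  sum-label = begin
    sum (label f)                                 ≡⟨ sum-permute (label f) (flip π) ⟩
    ∑[ i < n ] suc (toℕ (π ⟨$⟩ʳ (π ⟨$⟩ˡ i)))      ≡⟨ sum-cong-≗ (λ i → cong (λ j → suc (toℕ j)) (inverseʳ π {i})) ⟩
    ∑[ i < n ] suc (toℕ i)                        ≡⟨ ∑-suc {n} toℕ ⟩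
    ∑[ i < n ] toℕ i + n                          ∎
    where open ≡-Reasoning

module _ {n r} (G : Graph n) (regular : IsRegular r G) (f : Labeling n) where

  private
    count-adj : ∀ u → count (adj G u) ≡ r
    count-adj u = trans (sym (∣tabulate∣≡count (adj G u))) (regular u)

    count-neighbourLabels : ∀ u → count (neighbourLabels G f u) ≡ r
    count-neighbourLabels u = trans (sym (degree≡count G f u)) (regular u)

  weight-lower : ∀ u → r * suc r ≤ 2 * weight G f u
  weight-lower u = subst₂ (λ k w → k * suc k ≤ 2 * w)
    (count-neighbourLabels u) (sym (weight≡rankSum G f u)) (rankSum-lower (neighbourLabels G f u))

  weight-upper : ∀ u → 2 * weight G f u + r * r ≤ r * suc (2 * n)
  weight-upper u = subst₂ (λ k w → 2 * w + k * k ≤ k * suc (2 * n))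
    (count-neighbourLabels u) (sym (weight≡rankSum G f u)) (rankSum-upper (neighbourLabels G f u))

  sum-weight : sum (weight G f) ≡ r * (∑[ i < n ] toℕ i + n)
  sum-weight = begin
    sum (weight G f)                                           ≡⟨ sum-cong-≗ (λ u → sumFin≡sum n (entry u)) ⟩
    ∑[ u < n ] ∑[ v < n ] (if adj G u v then label f v else 0) ≡⟨ ∑-comm entry ⟩
    ∑[ v < n ] ∑[ u < n ] (if adj G u v then label f v else 0) ≡⟨ sum-cong-≗ column ⟩
    ∑[ v < n ] (r * label f v)                                 ≡⟨ *-distribˡ-sum r (label f) ⟨
    r * sum (label f)                                          ≡⟨ cong (r *_) (sum-label G f) ⟩
    r * (∑[ i < n ] toℕ i + n)                                 ∎
    where
    open ≡-Reasoning
    entry : Fin n → Fin n → ℕ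
    entry u v = if adj G u v then label f v else 0

    column : ∀ v → ∑[ u < n ] (if adj G u v then label f v else 0) ≡ r * label f v
    column v = begin
      ∑[ u < n ] (if adj G u v then label f v else 0) ≡⟨ sum-cong-≗ (λ u → cong (if_then label f v else 0) (symmetric G u v)) ⟩
      ∑[ u < n ] (if adj G v u then label f v else 0) ≡⟨ ∑-if-const (adj G v) (label f v) ⟩
      label f v * count (adj G v)                     ≡⟨ cong (label f v *_) (count-adj v) ⟩
      label f v * r                                   ≡⟨ *-comm (label f v) r ⟩
      r * label f v                                   ∎

antimagic⇒progression : ∀ {p} (G : Graph (suc p)) a d f →
                        IsDistanceAntimagicLabeling G a d f → ∃[ b ] HasProgressionValues (weight G f) b d
antimagic⇒progression G a d f (index , vertex) =
  w₀ , record { index = map₂ natural ∘ index ; vertex = map₂ natural ∘ vertex }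
  where
  w₀ : ℕ
  w₀ = weight G f (proj₁ (vertex zero))

  a≡w₀ : a ≡ ℤ.+ w₀
  a≡w₀ = sym (trans (proj₂ (vertex zero)) (ℤₚ.+-identityʳ a))

  natural : ∀ {x i} → ℤ.+ x ≡ a ℤ.+ ℤ.+ i → x ≡ w₀ + i
  natural {x} {i} eq =
    ℤₚ.+-injective (trans eq (trans (cong (ℤ._+ ℤ.+ i) a≡w₀) (sym (ℤₚ.pos-+ w₀ i))))

weight-sum⇒balance : ∀ p r b d T → 2 * T ≡ suc p * p → suc p * b + T * d ≡ r * (T + suc p) →
                2 * b + p * d ≡ r * (2 + p)
weight-sum⇒balance p r b d T gauss-T sum-eq = *-cancelˡ-≡ _ _ (suc p) (begin
  suc p * (2 * b + p * d)      ≡⟨ solve (p ∷ b ∷ d ∷ []) ⟩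
  2 * (suc p * b) + (suc p * p) * d ≡⟨ cong (λ t → 2 * (suc p * b) + t * d) gauss-T ⟨
  2 * (suc p * b) + (2 * T) * d ≡⟨ solve (p ∷ b ∷ d ∷ T ∷ []) ⟩
  2 * (suc p * b + T * d)      ≡⟨ cong (2 *_) sum-eq ⟩
  2 * (r * (T + suc p))        ≡⟨ solve (p ∷ r ∷ T ∷ []) ⟩
  r * (2 * T) + 2 * r * suc p  ≡⟨ cong (λ t → r * t + 2 * r * suc p) gauss-T ⟩
  r * (suc p * p) + 2 * r * suc p ≡⟨ solve (p ∷ r ∷ []) ⟩
  suc p * (r * (2 + p))        ∎)
  where open ≡-Reasoning

weight-bounds⇒spread : ∀ p r b d → r * suc r ≤ 2 * b → 2 * (b + p * d) + r * r ≤ r * suc (2 * suc p) →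
               p * d + r * r ≤ r * suc p
weight-bounds⇒spread p r b d lower upper = *-cancelˡ-≤ 2 (+-cancelˡ-≤ (r * suc r) _ _ (begin
  r * suc r + 2 * (p * d + r * r)       ≤⟨ +-monoˡ-≤ (2 * (p * d + r * r)) lower ⟩
  2 * b + 2 * (p * d + r * r)           ≡⟨ solve (p ∷ r ∷ b ∷ d ∷ []) ⟩
  (2 * (b + p * d) + r * r) + r * r     ≤⟨ +-monoˡ-≤ (r * r) upper ⟩
  r * suc (2 * suc p) + r * r           ≡⟨ solve (p ∷ r ∷ []) ⟩
  r * suc r + 2 * (r * suc p)           ∎))
  where open ≤-Reasoning

module _ {p r} (G : Graph (suc p)) (regular : IsRegular r G) (f : Labeling (suc p)) {b d}
         (progression : HasProgressionValues (weight G f) b d) where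

  regular-progression-balance : 2 * b + p * d ≡ r * (2 + p)
  regular-progression-balance = weight-sum⇒balance p r b d (∑[ i < suc p ] toℕ i) (gauss p)
    (trans (sym (sum-progression progression)) (sum-weight G regular f))

  regular-progression-spread : p * d + r * r ≤ r * suc p
  regular-progression-spread = weight-bounds⇒spread p r b d
    (subst (λ w → r * suc r ≤ 2 * w) min-weight (weight-lower G regular f _))
    (subst (λ w → 2 * w + r * r ≤ r * suc (2 * suc p)) max-weight (weight-upper G regular f _))
    where
    open HasProgressionValues progression
    min-weight : weight G f (proj₁ (vertex zero)) ≡ b
    min-weight = trans (proj₂ (vertex zero)) (+-identityʳ b)
    max-weight : weight G f (proj₁ (vertex (fromℕ p))) ≡ b + p * d
    max-weight = trans (proj₂ (vertex (fromℕ p))) (cong (λ i → b + i * d) (toℕ-fromℕ p))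

even-minus-four : ∀ m k → 4 + m ≡ 2 * k → ∃[ j ] m ≡ 2 * j
even-minus-four m (suc (suc j)) eq = j , +-cancelˡ-≡ 4 m (2 * j) (trans eq (solve (j ∷ [])))

odd-product : ∀ j → (1 + 2 * j) * (2 + (3 + 2 * j)) ≡ suc (2 * (2 * (j * j) + 6 * j + 2))
odd-product j = solve (j ∷ [])

difference≡1 : ∀ j b d →
               2 * b + (3 + 2 * j) * d ≡ (1 + 2 * j) * (2 + (3 + 2 * j)) →
               (3 + 2 * j) * d + (1 + 2 * j) * (1 + 2 * j) ≤ (1 + 2 * j) * suc (3 + 2 * j) →
               d ≡ 1
difference≡1 j b 0 balance _ =
  ⊥-elim (even≢odd b (2 * (j * j) + 6 * j + 2)
    (trans even (trans balance (odd-product j))))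
  where
  even : 2 * b ≡ 2 * b + (3 + 2 * j) * 0
  even = solve (j ∷ b ∷ [])
difference≡1 j b 1 _ _ = refl
difference≡1 j b 2 balance _ =
  ⊥-elim (even≢odd (b + (3 + 2 * j)) (2 * (j * j) + 6 * j + 2)
    (trans even (trans balance (odd-product j))))
  where
  even : 2 * (b + (3 + 2 * j)) ≡ 2 * b + (3 + 2 * j) * 2
  even = solve (j ∷ b ∷ [])
difference≡1 j b (suc (suc (suc e))) _ spread = contradiction spread (<⇒≱ (begin-strict
  (1 + 2 * j) * suc (3 + 2 * j)               <⟨ m<m+n _ {6} z<s ⟩
  (1 + 2 * j) * suc (3 + 2 * j) + 6           ≡⟨ solve (j ∷ []) ⟩
  (3 + 2 * j) * 3 + (1 + 2 * j) * (1 + 2 * j) ≤⟨ +-monoˡ-≤ _ (*-monoʳ-≤ (3 + 2 * j) (s≤s (s≤s (s≤s z≤n)))) ⟩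
  (3 + 2 * j) * (3 + e) + (1 + 2 * j) * (1 + 2 * j) ∎))
  where open ≤-Reasoning

lemma4p2 : (n : ℕ) → 4 ≤ n → ∃[ k ] n ≡ 2 * k →
    (G : Graph n) → IsRegular (n ∸ 3) G →
    (a : ℤ) (d : ℕ) → IsDistanceAntimagic G a d → d ≡ 1
lemma4p2 .(4 + m) (s≤s (s≤s (s≤s (s≤s {n = m} z≤n)))) (k , n≡2k) G regular a d (f , antimagic)
  with j , refl ← even-minus-four m k n≡2k
  with b , progression ← antimagic⇒progression G a d f antimagic
  = difference≡1 j b d (regular-progression-balance G regular f progression)
                       (regular-progression-spread G regular f progression)
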